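{- Define graphs $H_0,H_1,\dots$ recursively: $H_0$ is a single vertex; for $k\ge1$, $H_k$ consists of a complete graph $K_{2^{k+1}-1}$ with vertices numbered $1,\dots,2^{k+1}-1$, together with $2^{k+1}-1$ disjoint copies of $H_{k-1}$, where for each $i$ the $i$-th vertex of the clique is joined by an edge to one vertex of the $i$-th copy of $H_{k-1}$. Then for every $k\ge0$, $\chi_{cf}(H_k)=2^{k+1}-1$.
   Context: A path is a simple path (a single vertex counts). A conflict-free coloring of a graph with $k$ colors is a map from its vertices to $\{1,\dots,k\}$ such that for every path some color occurs exactly once on its vertices; $\chi_{cf}$ is the minimum such $k$. -}

module Defs where

open import Data.Nat using (ℕ; zero; suc; _^_; _∸_; _≤_)
open import Data.Fin using (Fin)
open import Data.Unit using (⊤; tt)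
open import Data.Sum using (_⊎_; inj₁; inj₂)
open import Data.Product using (Σ; _×_; _,_; ∃)
open import Data.Empty using (⊥)
open import Data.List using (List; []; _∷_)
open import Data.List.Membership.Propositional using (_∈_)
open import Data.List.Relation.Unary.Unique.Propositional using (Unique)
open import Data.List.Relation.Unary.Linked using (Linked)
open import Relation.Binary.PropositionalEquality using (_≡_; _≢_)
open import Relation.Nullary using (¬_)

record Graph : Set₁ where
  field
    V   : Set
    Adj : V → V → Set

open Graph public

record IsPath (G : Graph) (p : List (V G)) : Set where
  field
    nonempty : p ≢ []
    distinct : Unique p
    linked   : Linked (Adj G) p

UniqueColourOn : {G : Graph} {n : ℕ} → (V G → Fin n) → List (V G) → Set
UniqueColourOn {G} f p = Σ (V G) λ v → v ∈ p × (∀ w → w ∈ p → f w ≡ f v → w ≡ v)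

IsCFColouring : (G : Graph) (n : ℕ) → (V G → Fin n) → Set
IsCFColouring G n f = ∀ p → IsPath G p → UniqueColourOn {G} f p

CFColourable : Graph → ℕ → Set
CFColourable G n = Σ (V G → Fin n) (IsCFColouring G n)

χcf≡ : Graph → ℕ → Set
χcf≡ G n = CFColourable G n × (∀ m → CFColourable G m → n ≤ m)

cliqueSize : ℕ → ℕ
cliqueSize k = 2 ^ suc k ∸ 1

-- vertices of H_k: H_0 is one vertex; H_{k+1} has the clique vertices
-- inj₁ i and the vertices inj₂ (i , u) of the i-th copy of H_k.
HV : ℕ → Set
HV zero    = ⊤
HV (suc k) = Fin (cliqueSize (suc k)) ⊎ (Fin (cliqueSize (suc k)) × HV k)

-- A choice, for every level of the recursion, of the vertex of each copy
-- of H_{k-1} that is joined to the corresponding clique vertex.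
Attach : ℕ → Set
Attach zero    = ⊤
Attach (suc k) = Fin (cliqueSize (suc k)) → HV k × Attach k

HAdj : (k : ℕ) → Attach k → HV k → HV k → Set
HAdj zero    a       u v = ⊥
HAdj (suc k) a (inj₁ i)       (inj₁ j)       = i ≢ j
HAdj (suc k) a (inj₁ i)       (inj₂ (j , v)) = i ≡ j × v ≡ Data.Product.proj₁ (a i)
HAdj (suc k) a (inj₂ (i , u)) (inj₁ j)       = i ≡ j × u ≡ Data.Product.proj₁ (a i)
HAdj (suc k) a (inj₂ (i , u)) (inj₂ (j , v)) = i ≡ j × HAdj k (Data.Product.proj₂ (a i)) u v

H : (k : ℕ) → Attach k → Graph
H k a = record { V = HV k ; Adj = HAdj k a }

-- The lower bound holds because any two clique vertices of H_k form a path,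
-- so a conflict-free colouring is injective on the clique.  For the upper
-- bound, write n = 2m + 1 for the clique size of H_(k+1), where m colours
-- suffice for H_k.  Clique vertex i gets colour i, and the copy of H_k at i
-- is coloured with the m colours i + 1, …, i + m (mod n).  A path either
-- stays inside one copy, or it meets the clique in vertices x and y and its
-- other vertices lie in the copies at x and y.  Since at most one of x, y is
-- among the colours used on the copy at the other, one of the colours x, y
-- occurs only once on the path.
module Submission where

open import Defs
open import Data.Nat using (ℕ; zero; suc; _+_; _*_; _^_; _∸_; _<_; _≤_; z≤n; s≤s; NonZero)
open import Data.Nat.Properties
  using (+-suc; +-identityʳ; +-comm; +-cancelˡ-≡; *-distribʳ-+; m^n>0; suc-injective;
         m≤m+n; +-mono-≤; ≤-trans; +-commutativeSemigroup)
open import Data.Nat.DivMod using (_%_; _/_; _mod_; m≡m%n+[m/n]*n; [m+kn]%n≡m%n; m<n⇒m%n≡m)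
open import Algebra.Properties.CommutativeSemigroup +-commutativeSemigroup using (interchange)
open import Data.Fin using (Fin; toℕ; _≟_) renaming (zero to fzero)
open import Data.Fin.Properties using (toℕ-injective; toℕ-fromℕ<; toℕ<n; any?; injective⇒≤)
open import Data.Unit using (tt)
open import Data.Sum using (_⊎_; inj₁; inj₂)
open import Data.Sum.Properties using (inj₁-injective)
open import Data.Product using (_×_; _,_; ∃; ∃₂; proj₂)
open import Data.Empty using (⊥-elim)
open import Data.List using (List; []; _∷_; map)
open import Data.List.Membership.Propositional using (_∈_)
open import Data.List.Membership.Propositional.Properties using (∈-map⁺; ∈-map⁻)
open import Data.List.Relation.Unary.Any using (here; there)
open import Data.List.Relation.Unary.All as All using ([]; _∷_)
open import Data.List.Relation.Unary.AllPairs using ([]; _∷_)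
open import Data.List.Relation.Unary.Unique.Propositional using (Unique)
import Data.List.Relation.Unary.Unique.Propositional.Properties as Uniqueₚ
open import Data.List.Relation.Unary.Linked as Linked using (Linked; [-]; _∷_)
import Data.List.Relation.Unary.Linked.Properties as Linkedₚ
open import Function using (_∘_; Injective)
open import Relation.Binary.PropositionalEquality
open import Relation.Nullary using (yes; no)

residue-unique : ∀ {n a b} .{{_ : NonZero n}} c d →
                 a < n → b < n → a + c * n ≡ b + d * n → a ≡ b
residue-unique {n} {a} {b} c d a<n b<n eq = begin
  a               ≡⟨ m<n⇒m%n≡m a<n ⟨
  a % n           ≡⟨ [m+kn]%n≡m%n a c n ⟨
  (a + c * n) % n ≡⟨ cong (_% n) eq ⟩
  (b + d * n) % n ≡⟨ [m+kn]%n≡m%n b d n ⟩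
  b % n           ≡⟨ m<n⇒m%n≡m b<n ⟩
  b               ∎
  where open ≡-Reasoning

common-residue : ∀ n {x r d d′ q q′} →
                 x + d ≡ r + q * n → x + d′ ≡ r + q′ * n → d + q′ * n ≡ d′ + q * n
common-residue n {x} {r} {d} {d′} {q} {q′} eq eq′ = +-cancelˡ-≡ (x + r) _ _ (begin
  (x + r) + (d + q′ * n)  ≡⟨ interchange x r d (q′ * n) ⟩
  (x + d) + (r + q′ * n)  ≡⟨ cong₂ _+_ eq (sym eq′) ⟩
  (r + q * n) + (x + d′)  ≡⟨ interchange r (q * n) x d′ ⟩
  (r + x) + (q * n + d′)  ≡⟨ cong₂ _+_ (+-comm r x) (+-comm (q * n) d′) ⟩
  (x + r) + (d′ + q * n)  ∎)
  where open ≡-Reasoning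

round-trip : ∀ n {x y d e q q′} →
             x + d ≡ y + q * n → y + e ≡ x + q′ * n → d + e ≡ (q + q′) * n
round-trip n {x} {y} {d} {e} {q} {q′} eq eq′ = +-cancelˡ-≡ (x + y) _ _ (begin
  (x + y) + (d + e)          ≡⟨ interchange x y d e ⟩
  (x + d) + (y + e)          ≡⟨ cong₂ _+_ eq eq′ ⟩
  (y + q * n) + (x + q′ * n) ≡⟨ interchange y (q * n) x (q′ * n) ⟩
  (y + x) + (q * n + q′ * n) ≡⟨ cong₂ _+_ (+-comm y x) (sym (*-distribʳ-+ n q q′)) ⟩
  (x + y) + (q + q′) * n     ∎)
  where open ≡-Reasoning

-- An orientation of the complete graph on Fin n together with, for every
-- vertex i, an embedding of m colours into the out-neighbours of i.
record Recolouring (n m : ℕ) : Set where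
  field
    recolour           : Fin n → Fin m → Fin n
    recolour-injective : ∀ i → Injective _≡_ _≡_ (recolour i)
    recolour-≢         : ∀ i t → recolour i t ≢ i
    recolour-asym      : ∀ {i j} t s → recolour i t ≡ j → recolour j s ≢ i

  pair-misses-one : ∀ x y →
    (∀ {j} t → j ≡ x ⊎ j ≡ y → recolour j t ≢ x) ⊎
    (∀ {j} t → j ≡ x ⊎ j ≡ y → recolour j t ≢ y)
  pair-misses-one x y with any? (λ t → recolour y t ≟ x)
  ... | yes (t , y↦x) = inj₂ λ { s (inj₁ refl) → recolour-asym t s y↦x
                               ; s (inj₂ refl) → recolour-≢ y s }
  ... | no ¬y↦x       = inj₁ λ { t (inj₁ refl) → recolour-≢ x t
                               ; t (inj₂ refl) → ¬y↦x ∘ (t ,_) }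

module Rotation (m : ℕ) where

  N : ℕ
  N = suc (m + m)

  offset : Fin m → ℕ
  offset t = suc (toℕ t)

  offset+offset<N : ∀ t s → offset t + offset s < N
  offset+offset<N t s = s≤s (+-mono-≤ (toℕ<n t) (toℕ<n s))

  offset<N : ∀ t → offset t < N
  offset<N t = s≤s (≤-trans (toℕ<n t) (m≤m+n m m))

  rotate : Fin N → Fin m → Fin N
  rotate i t = (toℕ i + offset t) mod N

  rotate-≡ : ∀ i t → ∃ λ q → toℕ i + offset t ≡ toℕ (rotate i t) + q * N
  rotate-≡ i t = q , trans (m≡m%n+[m/n]*n (toℕ i + offset t) N) (cong (_+ q * N) (sym (toℕ-fromℕ< _)))
    where q = (toℕ i + offset t) / N

  rotate-injective : ∀ i → Injective _≡_ _≡_ (rotate i)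
  rotate-injective i {t} {t′} same with q , eq ← rotate-≡ i t | q′ , eq′ ← rotate-≡ i t′ =
    toℕ-injective (suc-injective (residue-unique q′ q (offset<N t) (offset<N t′)
      (common-residue N {x = toℕ i} {d = offset t} {d′ = offset t′} {q = q} {q′ = q′}
         eq (trans eq′ (cong (λ c → toℕ c + q′ * N) (sym same))))))

  rotate-≢ : ∀ i t → rotate i t ≢ i
  rotate-≢ i t back with q , eq ← rotate-≡ i t
    with () ← residue-unique 0 q (offset<N t) (s≤s z≤n)
                (trans (+-identityʳ _) (+-cancelˡ-≡ (toℕ i) _ _ (trans eq (cong (λ c → toℕ c + q * N) back))))

  -- The offsets of a round trip i → j → i sum to a number in [2, 2m], which is not a multiple of N.
  rotate-asym : ∀ {i j} t s → rotate i t ≡ j → rotate j s ≢ i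
  rotate-asym {i} t s refl back with q , eq ← rotate-≡ i t | q′ , eq′ ← rotate-≡ (rotate i t) s
    with () ← residue-unique 0 (q + q′) (offset+offset<N t s) (s≤s z≤n)
                (trans (+-identityʳ _) (round-trip N {x = toℕ i} {d = offset t} {e = offset s} {q = q} {q′ = q′}
                   eq (trans eq′ (cong (λ c → toℕ c + q′ * N) back))))

  rotation : Recolouring N m
  rotation = record
    { recolour           = rotate
    ; recolour-injective = rotate-injective
    ; recolour-≢         = rotate-≢
    ; recolour-asym      = rotate-asym
    }

cliqueSize-suc : ∀ k → cliqueSize (suc k) ≡ suc (cliqueSize k + cliqueSize k)
cliqueSize-suc k = 2*p∸1 (2 ^ suc k) (m^n>0 2 (suc k))
  where
    2*p∸1 : ∀ p → 0 < p → 2 * p ∸ 1 ≡ suc ((p ∸ 1) + (p ∸ 1))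
    2*p∸1 (suc p) _ = trans (cong (λ c → p + suc c) (+-identityʳ p)) (+-suc p p)

recolouring : ∀ k → Recolouring (cliqueSize (suc k)) (cliqueSize k)
recolouring k = subst (λ n → Recolouring n (cliqueSize k)) (sym (cliqueSize-suc k))
                      (Rotation.rotation (cliqueSize k))

colour : ∀ k → HV k → Fin (cliqueSize k)
colour zero    tt             = fzero
colour (suc k) (inj₁ i)       = i
colour (suc k) (inj₂ (i , u)) = Recolouring.recolour (recolouring k) i (colour k u)

copy : ∀ {k} → Fin (cliqueSize (suc k)) → HV k → HV (suc k)
copy j u = inj₂ (j , u)

∈-map-copy⇒≡ : ∀ {k j x} {u : HV k} {q} → copy j u ∈ map (copy x) q → j ≡ x
∈-map-copy⇒≡ m with ∈-map⁻ _ m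
... | _ , _ , refl = refl

module Paths {k : ℕ} (a : Attach (suc k)) where

  private
    G : Graph
    G = H (suc k) a

  CopiesIn : (Fin (cliqueSize (suc k)) → Set) → List (V G) → Set
  CopiesIn P p = ∀ {j u} → copy j u ∈ p → P j

  Crosses : Fin (cliqueSize (suc k)) → Fin (cliqueSize (suc k)) → List (V G) → Set
  Crosses x y p = inj₁ x ∈ p × inj₁ y ∈ p × CopiesIn (λ j → j ≡ x ⊎ j ≡ y) p

  walk-from-copy : ∀ {j u} r → Linked (Adj G) (copy j u ∷ r) →
                   (∃ λ q → r ≡ map (copy j) q) ⊎ inj₁ j ∈ r
  walk-from-copy []                 _                = inj₁ ([] , refl)
  walk-from-copy (inj₁ _ ∷ r)       ((refl , _) ∷ _) = inj₂ (here refl)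
  walk-from-copy (inj₂ (_ , u) ∷ r) ((refl , _) ∷ l) with walk-from-copy r l
  ... | inj₁ (q , r≡) = inj₁ (u ∷ q , cong (copy _ u ∷_) r≡)
  ... | inj₂ j∈r      = inj₂ (there j∈r)

  -- Once a path has entered the copy at x through x, it can never come back.
  path-from-clique : ∀ x r → Linked (Adj G) (inj₁ x ∷ r) → Unique (inj₁ x ∷ r) →
                     ∃ λ y → inj₁ y ∈ (inj₁ x ∷ r) × CopiesIn (_≡ y) (inj₁ x ∷ r)
  path-from-clique x [] _ _ = x , here refl , λ { (there ()) }
  path-from-clique x (inj₁ x′ ∷ r) (_ ∷ l) (_ ∷ un) with path-from-clique x′ r l un
  ... | y , y∈ , in-y = y , there y∈ , λ { (there m) → in-y m }
  path-from-clique x (inj₂ (_ , u) ∷ r) ((refl , _) ∷ l) (x∉ ∷ _) with walk-from-copy r l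
  ... | inj₁ (q , refl) = x , here refl , λ { (there m) → ∈-map-copy⇒≡ {q = u ∷ q} m }
  ... | inj₂ x∈r        = ⊥-elim (All.lookup x∉ (there x∈r) refl)

  path-from-copy : ∀ j u r → Linked (Adj G) (copy j u ∷ r) → Unique (copy j u ∷ r) →
                   (∃ λ q → copy j u ∷ r ≡ map (copy j) q) ⊎ (∃ λ y → Crosses j y (copy j u ∷ r))
  path-from-copy j u [] _ _ = inj₁ (u ∷ [] , refl)
  path-from-copy j u (inj₁ _ ∷ r) ((refl , _) ∷ l) (_ ∷ un) with path-from-clique j r l un
  ... | y , y∈ , in-y = inj₂ (y , there (here refl) , there y∈ ,
                              λ { (here refl) → inj₁ refl ; (there m) → inj₂ (in-y m) })
  path-from-copy j u (inj₂ (_ , u′) ∷ r) ((refl , _) ∷ l) (_ ∷ un) with path-from-copy j u′ r l un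
  ... | inj₁ (q , p≡) = inj₁ (u ∷ q , cong (copy j u ∷_) p≡)
  ... | inj₂ (y , x∈ , y∈ , in-xy) =
          inj₂ (y , there x∈ , there y∈ , λ { (here refl) → inj₁ refl ; (there m) → in-xy m })

  path-shape : ∀ {p} → IsPath G p → (∃₂ λ j q → p ≡ map (copy j) q) ⊎ (∃₂ λ x y → Crosses x y p)
  path-shape {[]} P = ⊥-elim (IsPath.nonempty P refl)
  path-shape {inj₁ x ∷ r} P with path-from-clique x r (IsPath.linked P) (IsPath.distinct P)
  ... | y , y∈ , in-y = inj₂ (x , y , here refl , y∈ , inj₂ ∘ in-y)
  path-shape {inj₂ (j , u) ∷ r} P with path-from-copy j u r (IsPath.linked P) (IsPath.distinct P)
  ... | inj₁ (q , p≡) = inj₁ (j , q , p≡)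
  ... | inj₂ (y , c)  = inj₂ (j , y , c)

  path-in-copy : ∀ {j q} → IsPath G (map (copy j) q) → IsPath (H k (proj₂ (a j))) q
  path-in-copy P = record
    { nonempty = λ { refl → IsPath.nonempty P refl }
    ; distinct = Uniqueₚ.map⁻ (IsPath.distinct P)
    ; linked   = Linked.map proj₂ (Linkedₚ.map⁻ (IsPath.linked P))
    }

  edge-path : ∀ {i j} → i ≢ j → IsPath G (inj₁ i ∷ inj₁ j ∷ [])
  edge-path i≢j = record
    { nonempty = λ ()
    ; distinct = ((i≢j ∘ inj₁-injective) ∷ []) ∷ [] ∷ []
    ; linked   = i≢j ∷ [-]
    }

module _ {k : ℕ} (a : Attach (suc k)) where

  open Paths a
  open Recolouring (recolouring k)

  clique-colour-unique : ∀ {c p} → inj₁ c ∈ p → CopiesIn (λ j → ∀ u → colour (suc k) (copy j u) ≢ c) p →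
                         UniqueColourOn {H (suc k) a} (colour (suc k)) p
  clique-colour-unique c∈ missed = inj₁ _ , c∈ , λ
    { (inj₁ i)       _  i≡c → cong inj₁ i≡c
    ; (inj₂ (j , u)) w∈ ≡c  → ⊥-elim (missed w∈ u ≡c) }

  copy-colour-unique : ∀ j q → UniqueColourOn {H k (proj₂ (a j))} (colour k) q →
                       UniqueColourOn {H (suc k) a} (colour (suc k)) (map (copy j) q)
  copy-colour-unique j q (v , v∈ , uniq) = copy j v , ∈-map⁺ (copy j) v∈ , λ _ → lift
    where
      lift : ∀ {w} → w ∈ map (copy j) q → colour (suc k) w ≡ colour (suc k) (copy j v) → w ≡ copy j v
      lift w∈ ≡v with ∈-map⁻ (copy j) w∈
      ... | u , u∈ , refl = cong (copy j) (uniq u u∈ (recolour-injective j ≡v))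

colour-cf : ∀ k a → IsCFColouring (H k a) (cliqueSize k) (colour k)
colour-cf zero    a []      P = ⊥-elim (IsPath.nonempty P refl)
colour-cf zero    a (_ ∷ _) _ = tt , here refl , λ _ _ _ → refl
colour-cf (suc k) a p P with Paths.path-shape a P
... | inj₁ (j , q , refl) = copy-colour-unique a j q (colour-cf k (proj₂ (a j)) q (Paths.path-in-copy a P))
... | inj₂ (x , y , x∈ , y∈ , in-xy) with Recolouring.pair-misses-one (recolouring k) x y
...   | inj₁ x-missed = clique-colour-unique a x∈ λ m u → x-missed (colour k u) (in-xy m)
...   | inj₂ y-missed = clique-colour-unique a y∈ λ m u → y-missed (colour k u) (in-xy m)

cf-colouring-injective-on-clique : ∀ {k a m} (f : HV (suc k) → Fin m) → IsCFColouring (H (suc k) a) m f →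
                                   Injective _≡_ _≡_ (f ∘ inj₁)
cf-colouring-injective-on-clique {a = a} f cf {i} {j} fi≡fj with i ≟ j
... | yes i≡j = i≡j
... | no i≢j with cf _ (Paths.edge-path a i≢j)
...   | _ , here refl         , uniq = ⊥-elim (i≢j (sym (inj₁-injective (uniq _ (there (here refl)) (sym fi≡fj)))))
...   | _ , there (here refl) , uniq = ⊥-elim (i≢j (inj₁-injective (uniq _ (here refl) fi≡fj)))

cf-colourable⇒cliqueSize≤ : ∀ k a m → CFColourable (H k a) m → cliqueSize k ≤ m
cf-colourable⇒cliqueSize≤ zero    a zero    (f , _) with () ← f tt
cf-colourable⇒cliqueSize≤ zero    a (suc m) _       = s≤s z≤n
cf-colourable⇒cliqueSize≤ (suc k) a m       (f , cf) = injective⇒≤ (cf-colouring-injective-on-clique f cf)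

lemma2 : (k : ℕ) → (a : Attach k) → χcf≡ (H k a) (2 ^ suc k ∸ 1)
lemma2 k a = (colour k , colour-cf k a) , cf-colourable⇒cliqueSize≤ k a
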